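{- For every $n\ge1$, the set $\mathcal{NCP}(n)$ equipped with the partially-defined binary operation $\circ$, defined on the set of admissible pairs with values in $\mathcal{NCP}(n)$, is a partial monoid, with unit the partition $0_n$.
   Context: A partition $\pi$ of $[m]=\{1,\dots,m\}$ is noncrossing if there are no two distinct blocks $B,C$ and elements $a<b<c<d$ with $a,c\in B$, $b,d\in C$. $\mathcal{NCP}(m)$ is the set of noncrossing partitions of $[m]$, a lattice for refinement ($\pi\mid\mu$ iff every block of $\pi$ lies in a block of $\mu$) with join $\vee$. $0_n$ is the partition of $[n]$ into singletons. For $\alpha,\beta\in\mathcal{NCP}(n)$, $\alpha\ast_n\beta$ is the partition of $[2n]$ with blocks $\{2x-1:x\in B\}$ for $B$ a block of $\alpha$ and $\{2x : x\in C\}$ for $C$ a block of $\beta$. The pair $(\alpha,\beta)$ is admissible if $\alpha\ast_n\beta$ is noncrossing. For an admissible pair, $\alpha\circ\beta:=\sqrt{(\alpha\ast_n\beta)\vee\{\{1,2\},\{3,4\},\dots,\{2n-1,2n\}\}}$, the join taken in $\mathcal{NCP}(2n)$, where for $\gamma\in\mathcal{NCP}(2n)$ in which $2i-1,2i$ lie in a common block for all $i$, $\sqrt\gamma\in\mathcal{NCP}(n)$ has blocks $\{i:2i\in D\}$ for $D$ a block of $\gamma$. The product $\alpha\circ\beta$ is undefined when $(\alpha,\beta)$ is not admissible. A partial monoid is a set $M$ with a subset $M_2\subset M\times M$ and a map $M_2\to M$, $(m_1,m_2)\mapsto m_1\cdot m_2$, such that for all $m_1,m_2,m_3$, $(m_1\cdot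 m_2)\cdot m_3$ is defined if and only if $m_1\cdot(m_2\cdot m_3)$ is defined, and then they are equal; and there is a neutral element $1$ with $1\cdot m$ and $m\cdot 1$ defined and equal to $m$ for all $m$. -}

module Defs where

open import Data.Nat using (ℕ; zero; suc; _*_)
open import Data.Fin using (Fin; zero; suc; _<_; _≟_; remQuot; combine; toℕ)
open import Data.Fin.Properties using (<-irrefl)
open import Data.Bool using (Bool; true; false; T; _∧_)
open import Data.Product using (Σ; _×_; _,_; proj₁; proj₂)
open import Relation.Nullary.Decidable using (⌊_⌋; toWitness; fromWitness)
open import Relation.Binary.PropositionalEquality using (_≡_; refl; sym; trans)
open import Data.Empty using (⊥-elim)

-- Conventions: [m] = {1,…,m} is represented by Fin m (0-based), element k ↦ k+1.
-- A set partition of [m] is represented by its (decidable) equivalence relation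
-- "lie in the same block", as a Bool-valued relation.

BRel : ℕ → Set
BRel m = Fin m → Fin m → Bool

Related : ∀ {m} → BRel m → Fin m → Fin m → Set
Related R i j = T (R i j)

record IsEquivalenceB {m : ℕ} (R : BRel m) : Set where
  field
    reflB  : ∀ i → Related R i i
    symB   : ∀ i j → Related R i j → Related R j i
    transB : ∀ i j k → Related R i j → Related R j k → Related R i k

-- No two distinct blocks B, C and a<b<c<d with a,c ∈ B and b,d ∈ C
-- (i.e. whenever a~c and b~d, the blocks coincide: a~b).
NonCrossing : ∀ {m} → BRel m → Set
NonCrossing {m} R = ∀ (a b c d : Fin m) → a < b → b < c → c < d →
  Related R a c → Related R b d → Related R a b

record NCP (m : ℕ) : Set where
  field
    rel         : BRel m
    isEquiv     : IsEquivalenceB rel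
    noncrossing : NonCrossing rel
open NCP public

_≤R_ : ∀ {m} → BRel m → BRel m → Set
R ≤R S = ∀ i j → Related R i j → Related S i j

_≈P_ : ∀ {m} → NCP m → NCP m → Set
π ≈P μ = ∀ i j → rel π i j ≡ rel μ i j

zeroRel : ∀ {n} → BRel n
zeroRel i j = ⌊ i ≟ j ⌋

0P : (n : ℕ) → NCP n
0P n = record
  { rel = zeroRel
  ; isEquiv = record
      { reflB = λ i → fromWitness {a? = i ≟ i} refl
      ; symB = λ i j p → fromWitness {a? = j ≟ i} (sym (toWitness {a? = i ≟ j} p))
      ; transB = λ i j k p q → fromWitness {a? = i ≟ k}
                   (trans (toWitness {a? = i ≟ j} p) (toWitness {a? = j ≟ k} q)) }
  ; noncrossing = λ a b c d a<b b<c c<d ac bd →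
      ⊥-elim (nc a b c a<b b<c (toWitness {a? = a ≟ c} ac)) }
  where
  open import Data.Fin.Properties using (<-trans)
  nc : ∀ {n} (a b c : Fin n) → a < b → b < c → a ≡ c → _
  nc a b c a<b b<c refl = <-irrefl refl (<-trans a<b b<c)

-- [2n] is represented by Fin (n * 2); combine x r = 2x + r (0-based).
-- 1-based 2x-1 (x ∈ [n]) ↔ 0-based combine x' 0, 1-based 2x ↔ combine x' 1.

-- α ∗ₙ β : α on the odd positions, β on the even positions (1-based)
star : ∀ {n} → NCP n → NCP n → BRel (n * 2)
star {n} α β p q with remQuot {n} 2 p | remQuot {n} 2 q
... | x , zero     | y , zero     = rel α x y
... | x , suc zero | y , suc zero = rel β x y
... | _ , _        | _ , _        = false

pairs : ∀ n → BRel (n * 2)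
pairs n p q = ⌊ proj₁ (remQuot {n} 2 p) ≟ proj₁ (remQuot {n} 2 q) ⌋

Admissible : ∀ {n} → NCP n → NCP n → Set
Admissible α β = NonCrossing (star α β)

IsJoinNCP : ∀ {m} → BRel m → BRel m → NCP m → Set
IsJoinNCP {m} R S γ =
  R ≤R rel γ × S ≤R rel γ ×
  (∀ (δ : NCP m) → R ≤R rel δ → S ≤R rel δ → rel γ ≤R rel δ)

-- √γ : blocks {i : 2i ∈ D}
sqrtRel : ∀ {n} → BRel (n * 2) → BRel n
sqrtRel R i j = R (combine i (suc zero)) (combine j (suc zero))

-- Comp α β μ : "α ∘ β is defined and equals μ"
Comp : ∀ {n} → NCP n → NCP n → NCP n → Set
Comp {n} α β μ = Admissible α β ×
  Σ (NCP (n * 2)) (λ γ → IsJoinNCP (star α β) (pairs n) γ ×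
                         (∀ i j → rel μ i j ≡ sqrtRel (rel γ) i j))

{-# OPTIONS --safe #-}
module Submission where

-- α ∘ β is the join α ∨ β in NCP(n): doubling a partition of [n] (i ↦ {2i-1, 2i}) and
-- taking √ are adjoint, so the join of α ∗ β with the pairs {2i-1, 2i} is the double of α ∨ β.
-- Drawing the blocks of α as chords between odd points and those of β between even points,
-- (α, β) is admissible iff no chord of α crosses a chord of β.  For fixed α these β are the
-- partitions below the Kreweras complement K(α), a noncrossing partition, so they are closed
-- under joins; symmetrically for fixed β and K⁻¹(β).  Hence (α ∘ β) ∘ γ and α ∘ (β ∘ γ) are
-- both defined iff α, β, γ are pairwise admissible, both are then α ∨ β ∨ γ, and 0ₙ is the
-- bottom of the lattice.

open import Defs
open import Data.Nat using (ℕ; _≤_)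
open import Data.Product using (Σ; _×_; Σ-syntax)
open import Function.Bundles using (_⇔_)

open import Data.Bool using (Bool; true; false; T; not; _xor_; b≤b)
import Data.Bool as Bool
open import Data.Bool.Properties
  using (xor-same; xor-comm; xor-inverseˡ; xor-inverseʳ; not-injective) renaming (≤-minimum to false≤)
open import Data.Empty using (⊥-elim)
open import Data.Fin as Fin using (Fin; zero; suc; _<_; _<?_; _≟_; combine; remQuot)
open import Data.Fin.Properties
  using (all?; <-trans; <-cmp; <-irrefl; <-asym; ≤∧≢⇒<; combine-monoˡ-<; remQuot-combine; combine-surjective)
open import Data.Fin.Subset using (Subset)
open import Data.Fin.Subset.Properties using (anySubset?)
import Data.Nat as ℕ
-- Fin's _<_ and _≤_ are ℕ's orders on toℕ, so Data.Nat.Properties applies to them.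
import Data.Nat.Properties as ℕ
open import Data.Product using (_,_; proj₁; uncurry)
open import Data.Sum using (_⊎_; inj₁; inj₂)
open import Data.Vec using (lookup; tabulate)
open import Data.Vec.Properties using (lookup∘tabulate)
open import Function using (_∘_)
open import Function.Bundles using (mk⇔; module Equivalence)
open import Function.Construct.Composition using (_⇔-∘_)
open import Function.Construct.Symmetry using (⇔-sym)
open import Relation.Binary.Definitions using (Monotonic₁; Antitonic₁; tri<; tri≈; tri>)
open import Relation.Binary.PropositionalEquality
  using (_≡_; refl; sym; trans; cong; cong₂; subst; subst₂; module ≡-Reasoning)
open import Relation.Nullary using (Dec; yes; no; ¬_; contradiction)
open import Relation.Nullary.Decidable
  using (⌊_⌋; toWitness; fromWitness; map′; _×-dec_; _→-dec_; ¬?; T?; decidable-stable)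
open import Relation.Unary using (Decidable)

open IsEquivalenceB

private variable
  k m : ℕ
  a b c d p q r : Fin m
  R S U : BRel m

T-injective : ∀ {x y} → (T x → T y) → (T y → T x) → x ≡ y
T-injective {false} {false} _ _ = refl
T-injective {false} {true}  _ g = ⊥-elim (g _)
T-injective {true}  {false} f _ = ⊥-elim (f _)
T-injective {true}  {true}  _ _ = refl

xor-transpose : ∀ w x y z → w xor x ≡ y xor z → w xor y ≡ x xor z
xor-transpose false x false .x refl = sym (xor-same x)
xor-transpose false .(not z) true z refl = sym (xor-inverseˡ z)
xor-transpose true x false .(not x) refl = sym (xor-inverseʳ x)
xor-transpose true x true z nx≡nz with refl ← not-injective nx≡nz = sym (xor-same x)

-- If g₂ = h₂, the two chains force g and h to agree at one of the ends as well.
xor-sandwich : ∀ {g₁ g₂ g₃ h₁ h₂ h₃} →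
  g₃ Bool.≤ g₂ → g₂ Bool.≤ g₁ → h₃ Bool.≤ h₂ → h₂ Bool.≤ h₁ →
  T (g₁ xor h₁) → T (g₃ xor h₃) → T (g₂ xor h₂)
xor-sandwich {g₂ = false} {h₂ = false} b≤b _ b≤b _ _ t₃ = t₃
xor-sandwich {g₂ = true}  {h₂ = true}  _ b≤b _ b≤b t₁ _ = t₁
xor-sandwich {g₂ = false} {h₂ = true}  _ _ _ _ _ _ = _
xor-sandwich {g₂ = true}  {h₂ = false} _ _ _ _ _ _ = _

-- Convex Boolean functions

Convex : (Fin m → Bool) → Set
Convex f = ∀ {a b c} → a < b → b < c → T (f a) → T (f c) → T (f b)

xor-antitone-convex : (g h : Fin m → Bool) → Antitonic₁ _<_ Bool._≤_ g → Antitonic₁ _<_ Bool._≤_ h →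
                      Convex (λ p → g p xor h p)
xor-antitone-convex _ _ g↓ h↓ a<b b<c = xor-sandwich (g↓ b<c) (g↓ a<b) (h↓ b<c) (h↓ a<b)

xor-monotone-convex : (g h : Fin m → Bool) → Monotonic₁ _<_ Bool._≤_ g → Monotonic₁ _<_ Bool._≤_ h →
                      Convex (λ p → g p xor h p)
xor-monotone-convex _ _ g↑ h↑ a<b b<c t₁ t₃ = xor-sandwich (g↑ a<b) (g↑ b<c) (h↑ a<b) (h↑ b<c) t₃ t₁

convex-∘ : ∀ {f : Fin m → Bool} {g : Fin k → Fin m} → Convex f → Monotonic₁ _<_ _<_ g → Convex (f ∘ g)
convex-∘ f-convex g↑ a<b b<c = f-convex (g↑ a<b) (g↑ b<c)

convex-kernel-noncrossing : ∀ {f : Fin m → Bool} → Convex f → a < b → b < c → c < d →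
                            f a ≡ f c → f b ≡ f d → f a ≡ f b
convex-kernel-noncrossing {a = a} {b} {f = f} f-convex a<b b<c c<d fa≡fc fb≡fd with f a in fa | f b in fb
... | false | false = refl
... | true  | true  = refl
... | true  | false = ⊥-elim (subst T fb (f-convex a<b b<c (subst T (sym fa) _) (subst T fa≡fc _)))
... | false | true  = ⊥-elim (subst T (sym fa≡fc) (f-convex b<c c<d (subst T (sym fb) _) (subst T fb≡fd _)))

module _ (ρ : BRel k) (f : Fin k → Fin k → Fin m → Bool) where

  Agree : Fin m → Fin m → Set
  Agree p q = ∀ i j → Related ρ i j → f i j p ≡ f i j q

  agree? : ∀ p q → Dec (Agree p q)
  agree? p q = all? λ i → all? λ j → T? (ρ i j) →-dec f i j p Bool.≟ f i j q

  private
    intro : ∀ {p q} → Agree p q → T ⌊ agree? p q ⌋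
    intro {p} {q} = fromWitness {a? = agree? p q}

    elim : ∀ {p q} → T ⌊ agree? p q ⌋ → Agree p q
    elim {p} {q} = toWitness {a? = agree? p q}

  agreeRel : BRel m
  agreeRel p q = ⌊ agree? p q ⌋

  jointKernel : (∀ i j → Convex (f i j)) → NCP m
  jointKernel f-convex = record
    { rel = agreeRel
    ; isEquiv = record
      { reflB  = λ p → intro λ _ _ _ → refl
      ; symB   = λ p q p~q → intro λ i j i~j → sym (elim p~q i j i~j)
      ; transB = λ p q r p~q q~r → intro λ i j i~j → trans (elim p~q i j i~j) (elim q~r i j i~j)
      }
    ; noncrossing = λ a b c d a<b b<c c<d a~c b~d → intro λ i j i~j →
        convex-kernel-noncrossing (f-convex i j) a<b b<c c<d (elim a~c i j i~j) (elim b~d i j i~j)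
    }

  ≤agreeRel⇔agree : S ≤R agreeRel ⇔ (∀ p q → Related S p q → Agree p q)
  ≤agreeRel⇔agree = mk⇔ (λ S≤ p q p~q → elim (S≤ p q p~q)) (λ S-agree p q p~q → intro (S-agree p q p~q))

-- Intervals and chords

below : Fin m → Fin m → Bool
below p a = ⌊ p <? a ⌋

-- p lies in the half-open interval between a and c that is closed at its lower end
inside : Fin m → Fin m → Fin m → Bool
inside a c p = below p a xor below p c

-- p lies in the half-open interval between q₁ and q₂ that is closed at its upper end
covers : Fin m → Fin m → Fin m → Bool
covers q₁ q₂ p = below q₁ p xor below q₂ p

below-true : p < a → below p a ≡ true
below-true {p = p} {a} p<a with p <? a
... | yes _   = refl
... | no p≮a  = ⊥-elim (p≮a p<a)

below-false : a Fin.≤ p → below p a ≡ false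
below-false {a = a} {p} a≤p with p <? a
... | yes p<a = ⊥-elim (ℕ.≤⇒≯ a≤p p<a)
... | no _    = refl

below-antitone : Antitonic₁ _<_ Bool._≤_ (λ p → below p a)
below-antitone {a = a} {p} {q} q<p with p <? a | q <? a
... | yes _   | yes _   = b≤b
... | yes p<a | no q≮a  = ⊥-elim (q≮a (<-trans q<p p<a))
... | no _    | _       = false≤ _

below-monotone : Monotonic₁ _<_ Bool._≤_ (below p)
below-monotone {p = p} {a} {b} a<b with p <? a | p <? b
... | yes _   | yes _   = b≤b
... | yes p<a | no p≮b  = ⊥-elim (p≮b (<-trans p<a a<b))
... | no _    | _       = false≤ _

inside-convex : Convex (inside a c)
inside-convex {a = a} {c} = xor-antitone-convex (λ p → below p a) (λ p → below p c) below-antitone below-antitone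

covers-convex : Convex (covers a c)
covers-convex {a = a} {c} = xor-monotone-convex (below a) (below c) below-monotone below-monotone

inside-between : a Fin.≤ p → p < c → inside a c p ≡ true
inside-between a≤p p<c = cong₂ _xor_ (below-false a≤p) (below-true p<c)

inside-before : p < a → p < c → inside a c p ≡ false
inside-before p<a p<c = cong₂ _xor_ (below-true p<a) (below-true p<c)

inside-after : a Fin.≤ p → c Fin.≤ p → inside a c p ≡ false
inside-after a≤p c≤p = cong₂ _xor_ (below-false a≤p) (below-false c≤p)

inside-true⇒between : a < c → inside a c p ≡ true → a Fin.≤ p × p < c
inside-true⇒between {a = a} {c} {p} a<c p-inside with p <? a | p <? c
inside-true⇒between a<c () | yes _ | yes _
inside-true⇒between a<c _  | yes p<a | no p≮c = ⊥-elim (p≮c (<-trans p<a a<c))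
inside-true⇒between a<c _  | no p≮a | yes p<c = ℕ.≮⇒≥ p≮a , p<c
inside-true⇒between a<c () | no _ | no _

inside-false⇒outside : inside a c p ≡ false → p < a ⊎ c Fin.≤ p
inside-false⇒outside {a = a} {c} {p} p-outside with p <? a | p <? c
... | yes p<a | _       = inj₁ p<a
... | no _    | no p≮c  = inj₂ (ℕ.≮⇒≥ p≮c)
inside-false⇒outside () | no _ | yes _

inside-transpose : ∀ (a c p q : Fin m) → inside a c p ≡ inside a c q → covers p q a ≡ covers p q c
inside-transpose a c p q = xor-transpose (below p a) (below p c) (below q a) (below q c)

covers-transpose : ∀ (a c p q : Fin m) → covers p q a ≡ covers p q c → inside a c p ≡ inside a c q
covers-transpose a c p q = xor-transpose (below p a) (below q a) (below p c) (below q c)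

module Blocks (γ : NCP m) where

  infix 4 _~_
  _~_ : Fin m → Fin m → Set
  p ~ q = Related (rel γ) p q

  ~-refl : p ~ p
  ~-refl = reflB (isEquiv γ) _

  ~-sym : p ~ q → q ~ p
  ~-sym = symB (isEquiv γ) _ _

  ~-trans : p ~ q → q ~ r → p ~ r
  ~-trans = transB (isEquiv γ) _ _ _

  noncrossing-≤ : a Fin.≤ b → b Fin.≤ c → c Fin.≤ d → a ~ c → b ~ d → a ~ b
  noncrossing-≤ {a = a} {b} {c} {d} a≤b b≤c c≤d a~c b~d with a ≟ b | b ≟ c | c ≟ d
  ... | yes refl | _        | _        = ~-refl
  ... | no _     | yes refl | _        = a~c
  ... | no _     | no _     | yes refl = ~-trans a~c (~-sym b~d)
  ... | no a≢b   | no b≢c   | no c≢d   =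
    noncrossing γ a b c d (≤∧≢⇒< a≤b a≢b) (≤∧≢⇒< b≤c b≢c) (≤∧≢⇒< c≤d c≢d) a~c b~d

  crossing⇒~ : a < c → inside a c b ≡ true → inside a c d ≡ false → a ~ c → b ~ d → a ~ b
  crossing⇒~ a<c b-inside d-outside a~c b~d
    with inside-true⇒between a<c b-inside | inside-false⇒outside d-outside
  ... | a≤b , b<c | inj₂ c≤d = noncrossing-≤ a≤b (ℕ.<⇒≤ b<c) c≤d a~c b~d
  ... | a≤b , b<c | inj₁ d<a =
    ~-trans (~-sym (noncrossing-≤ (ℕ.<⇒≤ d<a) a≤b (ℕ.<⇒≤ b<c) (~-sym b~d) a~c)) (~-sym b~d)

  private
    sameSide< : a < c → a ~ c → b ~ d → ¬ a ~ b → inside a c b ≡ inside a c d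
    sameSide< {a = a} {c} {b} {d} a<c a~c b~d a≁b with inside a c b in b-side | inside a c d in d-side
    ... | false | false = refl
    ... | true  | true  = refl
    ... | true  | false = ⊥-elim (a≁b (crossing⇒~ a<c b-side d-side a~c b~d))
    ... | false | true  = ⊥-elim (a≁b (~-trans (crossing⇒~ a<c d-side b-side a~c (~-sym b~d)) (~-sym b~d)))

  ≁⇒sameSide : a ~ c → b ~ d → ¬ a ~ b → inside a c b ≡ inside a c d
  ≁⇒sameSide {a = a} {c} {b} {d} a~c b~d a≁b with <-cmp a c
  ... | tri< a<c _ _ = sameSide< a<c a~c b~d a≁b
  ... | tri≈ _ refl _ = trans (xor-same (below b a)) (sym (xor-same (below d a)))
  ... | tri> _ _ c<a = begin
    inside a c b ≡⟨ xor-comm (below b a) (below b c) ⟩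
    inside c a b ≡⟨ sameSide< c<a (~-sym a~c) b~d (a≁b ∘ ~-trans a~c) ⟩
    inside c a d ≡⟨ xor-comm (below d c) (below d a) ⟩
    inside a c d ∎
    where open ≡-Reasoning

-- Joins in NCP(m)

≤R-refl : R ≤R R
≤R-refl _ _ h = h

≤R-trans : R ≤R S → S ≤R U → R ≤R U
≤R-trans R≤S S≤U i j h = S≤U i j (R≤S i j h)

≤R-antisym : R ≤R S → S ≤R R → ∀ i j → R i j ≡ S i j
≤R-antisym R≤S S≤R i j = T-injective (R≤S i j) (S≤R i j)

zeroRel-least : (α : NCP m) → zeroRel ≤R rel α
zeroRel-least α i j i≡j = subst (Related (rel α) i) (toWitness {a? = i ≟ j} i≡j) (reflB (isEquiv α) i)

isJoin-unique : (μ ν : NCP m) → IsJoinNCP R S μ → IsJoinNCP R S ν → μ ≈P ν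
isJoin-unique μ ν (R≤μ , S≤μ , μ-least) (R≤ν , S≤ν , ν-least) =
  ≤R-antisym (μ-least ν R≤ν S≤ν) (ν-least μ R≤μ S≤μ)

isJoin-resp-≈ : (μ ν : NCP m) → IsJoinNCP R S μ → μ ≈P ν → IsJoinNCP R S ν
isJoin-resp-≈ {R = R} {S} μ ν (R≤μ , S≤μ , μ-least) μ≈ν = ≤R-trans R≤μ μ≤ν , ≤R-trans S≤μ μ≤ν , ν-least
  where
  μ≤ν : rel μ ≤R rel ν
  μ≤ν i j = subst T (μ≈ν i j)
  ν-least : ∀ δ → R ≤R rel δ → S ≤R rel δ → rel ν ≤R rel δ
  ν-least δ R≤δ S≤δ i j = μ-least δ R≤δ S≤δ i j ∘ subst T (sym (μ≈ν i j))

isJoin-assoc : (μ ρ ν σ : NCP m) → IsJoinNCP R S μ → IsJoinNCP (rel μ) U ρ →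
               IsJoinNCP S U ν → IsJoinNCP R (rel ν) σ → ρ ≈P σ
isJoin-assoc μ ρ ν σ (R≤μ , S≤μ , μ-least) (μ≤ρ , U≤ρ , ρ-least) (S≤ν , U≤ν , ν-least) (R≤σ , ν≤σ , σ-least) =
  ≤R-antisym
    (ρ-least σ (μ-least σ R≤σ (≤R-trans S≤ν ν≤σ)) (≤R-trans U≤ν ν≤σ))
    (σ-least ρ (≤R-trans R≤μ μ≤ρ) (ν-least ρ (≤R-trans S≤μ μ≤ρ) U≤ρ))

≤⇒isJoinˡ : (α : NCP m) → R ≤R rel α → IsJoinNCP R (rel α) α
≤⇒isJoinˡ α R≤α = R≤α , ≤R-refl , λ _ _ α≤δ → α≤δ

≤⇒isJoinʳ : (α : NCP m) → R ≤R rel α → IsJoinNCP (rel α) R α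
≤⇒isJoinʳ α R≤α = ≤R-refl , R≤α , λ _ α≤δ _ → α≤δ

isEquivalenceB? : (δ : BRel m) → Dec (IsEquivalenceB δ)
isEquivalenceB? δ = map′ (λ (r , s , t) → record { reflB = r ; symB = s ; transB = t })
                          (λ e → reflB e , symB e , transB e)
  (all? (λ i → T? (δ i i)) ×-dec
   all? (λ i → all? λ j → T? (δ i j) →-dec T? (δ j i)) ×-dec
   all? (λ i → all? λ j → all? λ k → T? (δ i j) →-dec T? (δ j k) →-dec T? (δ i k)))

nonCrossing? : (δ : BRel m) → Dec (NonCrossing δ)
nonCrossing? δ = all? λ a → all? λ b → all? λ c → all? λ d →
  a <? b →-dec b <? c →-dec c <? d →-dec T? (δ a c) →-dec T? (δ b d) →-dec T? (δ a b)

≤R? : (R S : BRel m) → Dec (R ≤R S)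
≤R? R S = all? λ i → all? λ j → T? (R i j) →-dec T? (S i j)

NCUpperBound : BRel m → BRel m → BRel m → Set
NCUpperBound R S δ = IsEquivalenceB δ × NonCrossing δ × R ≤R δ × S ≤R δ

ncUpperBound? : (R S δ : BRel m) → Dec (NCUpperBound R S δ)
ncUpperBound? R S δ = isEquivalenceB? δ ×-dec nonCrossing? δ ×-dec ≤R? R δ ×-dec ≤R? S δ

ncUpperBound-resp : ∀ {δ δ′ : BRel m} → (∀ i j → δ i j ≡ δ′ i j) → NCUpperBound R S δ → NCUpperBound R S δ′
ncUpperBound-resp {δ = δ} {δ′} δ≗δ′ (δ-equiv , δ-nc , R≤δ , S≤δ) =
  δ′-equiv , δ′-nc , ≤R-trans R≤δ δ≤δ′ , ≤R-trans S≤δ δ≤δ′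
  where
  δ≤δ′ : δ ≤R δ′
  δ≤δ′ i j = subst T (δ≗δ′ i j)
  δ′≤δ : δ′ ≤R δ
  δ′≤δ i j = subst T (sym (δ≗δ′ i j))
  δ′-equiv : IsEquivalenceB δ′
  δ′-equiv = record
    { reflB  = λ i → δ≤δ′ i i (reflB δ-equiv i)
    ; symB   = λ i j h → δ≤δ′ j i (symB δ-equiv i j (δ′≤δ i j h))
    ; transB = λ i j k h₁ h₂ → δ≤δ′ i k (transB δ-equiv i j k (δ′≤δ i j h₁) (δ′≤δ j k h₂))
    }
  δ′-nc : NonCrossing δ′
  δ′-nc a b c d a<b b<c c<d a~c b~d = δ≤δ′ a b (δ-nc a b c d a<b b<c c<d (δ′≤δ a c a~c) (δ′≤δ b d b~d))

-- The join relates i and j iff every noncrossing equivalence above R and S does.  Enumerating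
-- the relations on [m] as the subsets of [m * m] makes this quantifier decidable.
decode : Subset (m ℕ.* m) → BRel m
decode s i j = lookup s (combine i j)

encode : BRel m → Subset (m ℕ.* m)
encode {m} δ = tabulate (uncurry δ ∘ remQuot m)

decode-encode : ∀ (δ : BRel m) i j → decode (encode δ) i j ≡ δ i j
decode-encode {m} δ i j =
  trans (lookup∘tabulate (uncurry δ ∘ remQuot m) (combine i j)) (cong (uncurry δ) (remQuot-combine i j))

allSubsets? : ∀ {P : Subset k → Set} → Decidable P → Dec (∀ s → P s)
allSubsets? P? = map′ (λ ∄¬P s → decidable-stable (P? s) (λ ¬Ps → ∄¬P (s , ¬Ps)))
                      (λ ∀P (s , ¬Ps) → ¬Ps (∀P s))
                      (¬? (anySubset? (¬? ∘ P?)))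

module _ (R S : BRel m) where

  InJoin : Fin m → Fin m → Set
  InJoin i j = ∀ s → NCUpperBound R S (decode s) → Related (decode s) i j

  inJoin? : ∀ i j → Dec (InJoin i j)
  inJoin? i j = allSubsets? λ s → ncUpperBound? R S (decode s) →-dec T? (decode s i j)

  private
    intro : ∀ {i j} → InJoin i j → T ⌊ inJoin? i j ⌋
    intro {i} {j} = fromWitness {a? = inJoin? i j}

    elim : ∀ {i j} → T ⌊ inJoin? i j ⌋ → InJoin i j
    elim {i} {j} = toWitness {a? = inJoin? i j}

  join : NCP m
  join = record
    { rel = λ i j → ⌊ inJoin? i j ⌋
    ; isEquiv = record
      { reflB  = λ i → intro λ s (δ-equiv , _) → reflB δ-equiv i
      ; symB   = λ i j h → intro λ s ub@(δ-equiv , _) → symB δ-equiv i j (elim h s ub)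
      ; transB = λ i j k h₁ h₂ → intro λ s ub@(δ-equiv , _) → transB δ-equiv i j k (elim h₁ s ub) (elim h₂ s ub)
      }
    ; noncrossing = λ a b c d a<b b<c c<d a~c b~d → intro λ s ub@(_ , δ-nc , _) →
        δ-nc a b c d a<b b<c c<d (elim a~c s ub) (elim b~d s ub)
    }

  join-isJoin : IsJoinNCP R S join
  join-isJoin =
    (λ i j h → intro λ _ (_ , _ , R≤δ , _) → R≤δ i j h) ,
    (λ i j h → intro λ _ (_ , _ , _ , S≤δ) → S≤δ i j h) ,
    λ δ R≤δ S≤δ i j h →
      subst T (decode-encode (rel δ) i j)
        (elim h (encode (rel δ))
          (ncUpperBound-resp (λ i j → sym (decode-encode (rel δ) i j)) (isEquiv δ , noncrossing δ , R≤δ , S≤δ)))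

_∨_ : NCP m → NCP m → NCP m
α ∨ β = join (rel α) (rel β)

-- The doubled interval [2n]

combine-reflects-≤ : ∀ {x y : Fin m} {i j : Fin k} → combine x i < combine y j → x Fin.≤ y
combine-reflects-≤ {i = i} {j} xi<yj = ℕ.≮⇒≥ λ y<x → <-asym xi<yj (combine-monoˡ-< j i y<x)

combine-cancelʳ-< : ∀ {x y : Fin m} {i : Fin k} → combine x i < combine y i → x < y
combine-cancelʳ-< xi<yi = ≤∧≢⇒< (combine-reflects-≤ xi<yi) λ { refl → <-irrefl refl xi<yi }

module _ {n : ℕ} where

  -- Parities refer to the paper's 1-based numbering: odd x and even x are 2x-1 and 2x.
  odd even : Fin n → Fin (n ℕ.* 2)
  odd x = combine x zero
  even x = combine x (suc zero)

  odd-mono : Monotonic₁ _<_ _<_ odd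
  odd-mono = combine-monoˡ-< zero zero

  even-mono : Monotonic₁ _<_ _<_ even
  even-mono = combine-monoˡ-< (suc zero) (suc zero)

  half : Fin (n ℕ.* 2) → Fin n
  half p = proj₁ (remQuot {n} 2 p)

  data Parity : Fin (n ℕ.* 2) → Set where
    at-odd  : ∀ x → Parity (odd x)
    at-even : ∀ x → Parity (even x)

  parity : ∀ p → Parity p
  parity p with combine-surjective {n} {2} p
  ... | x , zero , refl     = at-odd x
  ... | x , suc zero , refl = at-even x

  half-combine : ∀ x i → half (combine x i) ≡ x
  half-combine x i = cong proj₁ (remQuot-combine x i)

  half-mono : ∀ {p q} → p < q → half p Fin.≤ half q
  half-mono {p} {q} p<q with combine-surjective {n} {2} p | combine-surjective {n} {2} q
  ... | x , i , refl | y , j , refl =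
    subst₂ Fin._≤_ (sym (half-combine x i)) (sym (half-combine y j)) (combine-reflects-≤ p<q)

  module _ {α β : NCP n} {x y : Fin n} where

    star-odd-odd : star α β (odd x) (odd y) ≡ rel α x y
    star-odd-odd rewrite remQuot-combine {n} {2} x zero | remQuot-combine {n} {2} y zero = refl

    star-even-even : star α β (even x) (even y) ≡ rel β x y
    star-even-even rewrite remQuot-combine {n} {2} x (suc zero) | remQuot-combine {n} {2} y (suc zero) = refl

    star-odd-even : ¬ Related (star α β) (odd x) (even y)
    star-odd-even rewrite remQuot-combine {n} {2} x zero | remQuot-combine {n} {2} y (suc zero) = λ ()

    star-even-odd : ¬ Related (star α β) (even x) (odd y)
    star-even-odd rewrite remQuot-combine {n} {2} x (suc zero) | remQuot-combine {n} {2} y zero = λ ()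

  data StarRelated (α β : NCP n) : Fin (n ℕ.* 2) → Fin (n ℕ.* 2) → Set where
    odds  : ∀ {x y} → Related (rel α) x y → StarRelated α β (odd x) (odd y)
    evens : ∀ {x y} → Related (rel β) x y → StarRelated α β (even x) (even y)

  module _ {α β : NCP n} where

    star-related : ∀ {p q} → Related (star α β) p q → StarRelated α β p q
    star-related {p} {q} p~q with parity p | parity q
    ... | at-odd _  | at-odd _  = odds (subst T star-odd-odd p~q)
    ... | at-even _ | at-even _ = evens (subst T star-even-even p~q)
    ... | at-odd _  | at-even _ = ⊥-elim (star-odd-even p~q)
    ... | at-even _ | at-odd _  = ⊥-elim (star-even-odd p~q)

    starRelated⇒star : ∀ {p q} → StarRelated α β p q → Related (star α β) p q
    starRelated⇒star (odds x~y)  = subst T (sym star-odd-odd) x~y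
    starRelated⇒star (evens x~y) = subst T (sym star-even-even) x~y

    star-isEquivalence : IsEquivalenceB (star α β)
    star-isEquivalence = record { reflB = star-refl ; symB = λ _ _ → star-sym ; transB = λ _ _ r → star-trans r }
      where
      star-refl : ∀ p → Related (star α β) p p
      star-refl p with parity p
      ... | at-odd x  = starRelated⇒star (odds (reflB (isEquiv α) x))
      ... | at-even x = starRelated⇒star (evens (reflB (isEquiv β) x))

      star-sym : ∀ {p q} → Related (star α β) p q → Related (star α β) q p
      star-sym p~q with star-related p~q
      ... | odds x~y  = starRelated⇒star (odds (symB (isEquiv α) _ _ x~y))
      ... | evens x~y = starRelated⇒star (evens (symB (isEquiv β) _ _ x~y))

      star-trans : ∀ {p q} r → Related (star α β) p q → Related (star α β) q r → Related (star α β) p r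
      star-trans r p~q q~r with star-related p~q | parity r
      ... | odds x~y  | at-odd _  =
        starRelated⇒star (odds (transB (isEquiv α) _ _ _ x~y (subst T star-odd-odd q~r)))
      ... | evens x~y | at-even _ =
        starRelated⇒star (evens (transB (isEquiv β) _ _ _ x~y (subst T star-even-even q~r)))
      ... | odds _    | at-even _ = ⊥-elim (star-odd-even q~r)
      ... | evens _   | at-odd _  = ⊥-elim (star-even-odd q~r)

    starNCP : Admissible α β → NCP (n ℕ.* 2)
    starNCP adm = record { rel = star α β ; isEquiv = star-isEquivalence ; noncrossing = adm }

  double : NCP n → NCP (n ℕ.* 2)
  double μ = record
    { rel = λ p q → rel μ (half p) (half q)
    ; isEquiv = record
      { reflB  = λ p → reflB (isEquiv μ) (half p)
      ; symB   = λ p q → symB (isEquiv μ) (half p) (half q)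
      ; transB = λ p q r → transB (isEquiv μ) (half p) (half q) (half r)
      }
    ; noncrossing = λ _ _ _ _ a<b b<c c<d → Blocks.noncrossing-≤ μ (half-mono a<b) (half-mono b<c) (half-mono c<d)
    }

  √ : NCP (n ℕ.* 2) → NCP n
  √ γ = record
    { rel = sqrtRel (rel γ)
    ; isEquiv = record
      { reflB  = λ x → reflB (isEquiv γ) (even x)
      ; symB   = λ x y → symB (isEquiv γ) (even x) (even y)
      ; transB = λ x y z → transB (isEquiv γ) (even x) (even y) (even z)
      }
    ; noncrossing = λ a b c d a<b b<c c<d →
        noncrossing γ (even a) (even b) (even c) (even d) (even-mono a<b) (even-mono b<c) (even-mono c<d)
    }

  double-mono : {μ ν : NCP n} → rel μ ≤R rel ν → rel (double μ) ≤R rel (double ν)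
  double-mono μ≤ν p q = μ≤ν (half p) (half q)

  double-combine : (μ : NCP n) {x y : Fin n} {i j : Fin 2} →
                   Related (rel μ) x y → Related (rel (double μ)) (combine x i) (combine y j)
  double-combine μ {x} {y} {i} {j} = subst T (sym (cong₂ (rel μ) (half-combine x i) (half-combine y j)))

  √-double : (μ : NCP n) → ∀ x y → rel (√ (double μ)) x y ≡ rel μ x y
  √-double μ x y = cong₂ (rel μ) (half-combine x (suc zero)) (half-combine y (suc zero))

  star≤double : (α β μ : NCP n) → rel α ≤R rel μ → rel β ≤R rel μ → star α β ≤R rel (double μ)
  star≤double α β μ α≤μ β≤μ p q p~q with star-related p~q
  ... | odds x~y  = double-combine μ (α≤μ _ _ x~y)
  ... | evens x~y = double-combine μ (β≤μ _ _ x~y)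

  pairs≤double : (μ : NCP n) → pairs n ≤R rel (double μ)
  pairs≤double μ p q same-pair =
    subst (Related (rel μ) (half p)) (toWitness {a? = half p ≟ half q} same-pair) (reflB (isEquiv μ) (half p))

  module _ (γ : NCP (n ℕ.* 2)) (pairs≤γ : pairs n ≤R rel γ) where
    open Blocks γ

    private
      same-pair : ∀ {p q} → half p ≡ half q → p ~ q
      same-pair {p} {q} eq = pairs≤γ p q (fromWitness {a? = half p ≟ half q} eq)

    double-√≤ : rel (double (√ γ)) ≤R rel γ
    double-√≤ p q h =
      ~-trans (same-pair (sym (half-combine (half p) _))) (~-trans h (same-pair (half-combine (half q) _)))

    odd~even : ∀ x → odd x ~ even x
    odd~even x = same-pair (trans (half-combine x _) (sym (half-combine x _)))

    module _ (α β : NCP n) (star≤γ : star α β ≤R rel γ) where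

      star≤⇒≤√ˡ : rel α ≤R rel (√ γ)
      star≤⇒≤√ˡ x y x~y =
        ~-trans (~-sym (odd~even x)) (~-trans (star≤γ _ _ (starRelated⇒star (odds x~y))) (odd~even y))

      star≤⇒≤√ʳ : rel β ≤R rel (√ γ)
      star≤⇒≤√ʳ x y x~y = star≤γ _ _ (starRelated⇒star (evens x~y))

  √-isJoin : (α β : NCP n) (γ : NCP (n ℕ.* 2)) →
             IsJoinNCP (star α β) (pairs n) γ → IsJoinNCP (rel α) (rel β) (√ γ)
  √-isJoin α β γ (star≤γ , pairs≤γ , γ-least) =
    star≤⇒≤√ˡ γ pairs≤γ α β star≤γ , star≤⇒≤√ʳ γ pairs≤γ α β star≤γ ,
    λ δ α≤δ β≤δ x y x~y →
      subst T (√-double δ x y)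
        (γ-least (double δ) (star≤double α β δ α≤δ β≤δ) (pairs≤double δ) (even x) (even y) x~y)

  double-isJoin : (α β μ : NCP n) → IsJoinNCP (rel α) (rel β) μ → IsJoinNCP (star α β) (pairs n) (double μ)
  double-isJoin α β μ (α≤μ , β≤μ , μ-least) =
    star≤double α β μ α≤μ β≤μ , pairs≤double μ ,
    λ δ star≤δ pairs≤δ → ≤R-trans
      (double-mono {μ} {√ δ} (μ-least (√ δ) (star≤⇒≤√ˡ δ pairs≤δ α β star≤δ) (star≤⇒≤√ʳ δ pairs≤δ α β star≤δ)))
      (double-√≤ δ pairs≤δ)

  comp⇒isJoin : (α β μ : NCP n) → Comp α β μ → IsJoinNCP (rel α) (rel β) μ
  comp⇒isJoin α β μ (_ , γ , γ-join , μ≡√γ) =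
    isJoin-resp-≈ (√ γ) μ (√-isJoin α β γ γ-join) (λ x y → sym (μ≡√γ x y))

  isJoin⇒comp : (α β μ : NCP n) → Admissible α β → IsJoinNCP (rel α) (rel β) μ → Comp α β μ
  isJoin⇒comp α β μ adm μ-join = adm , double μ , double-isJoin α β μ μ-join , λ x y → sym (√-double μ x y)

  -- Admissibility and Kreweras complements

  evenSide oddSide : Fin n → Fin n → Fin n → Bool
  evenSide x₁ x₂ y = inside (odd x₁) (odd x₂) (even y)
  oddSide y₁ y₂ x = covers (even y₁) (even y₂) (odd x)

  Separated : BRel n → BRel n → Set
  Separated π σ = ∀ x₁ x₂ y₁ y₂ → Related π x₁ x₂ → Related σ y₁ y₂ → evenSide x₁ x₂ y₁ ≡ evenSide x₁ x₂ y₂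

  separated-anti : ∀ {π π′ σ σ′} → π′ ≤R π → σ′ ≤R σ → Separated π σ → Separated π′ σ′
  separated-anti π′≤π σ′≤σ sep x₁ x₂ y₁ y₂ x₁~x₂ y₁~y₂ = sep x₁ x₂ y₁ y₂ (π′≤π x₁ x₂ x₁~x₂) (σ′≤σ y₁ y₂ y₁~y₂)

  separated-zeroˡ : Separated zeroRel R
  separated-zeroˡ x₁ x₂ y₁ y₂ x₁≡x₂ _ with refl ← toWitness {a? = x₁ ≟ x₂} x₁≡x₂ =
    trans (xor-same (below (even y₁) (odd x₁))) (sym (xor-same (below (even y₂) (odd x₁))))

  separated-zeroʳ : Separated R zeroRel
  separated-zeroʳ x₁ x₂ y₁ y₂ _ y₁≡y₂ with refl ← toWitness {a? = y₁ ≟ y₂} y₁≡y₂ = refl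

  admissible⇒separated : (α β : NCP n) → Admissible α β → Separated (rel α) (rel β)
  admissible⇒separated α β adm x₁ x₂ y₁ y₂ x₁~x₂ y₁~y₂ =
    Blocks.≁⇒sameSide (starNCP adm) (starRelated⇒star (odds x₁~x₂)) (starRelated⇒star (evens y₁~y₂)) star-odd-even

  separated⇒admissible : (α β : NCP n) → Separated (rel α) (rel β) → Admissible α β
  separated⇒admissible α β sep a b c d a<b b<c c<d a~c b~d with star-related a~c | star-related b~d
  ... | odds x₁~x₃ | odds x₂~x₄ = starRelated⇒star (odds
    (noncrossing α _ _ _ _ (combine-cancelʳ-< a<b) (combine-cancelʳ-< b<c) (combine-cancelʳ-< c<d) x₁~x₃ x₂~x₄))
  ... | evens y₁~y₃ | evens y₂~y₄ = starRelated⇒star (evens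
    (noncrossing β _ _ _ _ (combine-cancelʳ-< a<b) (combine-cancelʳ-< b<c) (combine-cancelʳ-< c<d) y₁~y₃ y₂~y₄))
  ... | odds x₁~x₃ | evens y₂~y₄ = contradiction (begin
    true         ≡⟨ sym (inside-between (ℕ.<⇒≤ a<b) b<c) ⟩
    inside a c b ≡⟨ sep _ _ _ _ x₁~x₃ y₂~y₄ ⟩
    inside a c d ≡⟨ inside-after (ℕ.<⇒≤ (<-trans a<b (<-trans b<c c<d))) (ℕ.<⇒≤ c<d) ⟩
    false        ∎) λ ()
    where open ≡-Reasoning
  ... | evens y₁~y₃ | odds x₂~x₄ = contradiction (begin
    false        ≡⟨ sym (inside-before a<b (<-trans a<b (<-trans b<c c<d))) ⟩
    inside b d a ≡⟨ sep _ _ _ _ x₂~x₄ y₁~y₃ ⟩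
    inside b d c ≡⟨ inside-between (ℕ.<⇒≤ b<c) c<d ⟩
    true         ∎) λ ()
    where open ≡-Reasoning

  kreweras : NCP n → NCP n
  kreweras π = jointKernel (rel π) evenSide λ x₁ x₂ → convex-∘ (inside-convex {a = odd x₁} {odd x₂}) even-mono

  kreweras⁻¹ : NCP n → NCP n
  kreweras⁻¹ σ = jointKernel (rel σ) oddSide λ y₁ y₂ → convex-∘ (covers-convex {a = even y₁} {even y₂}) odd-mono

  ≤kreweras⇔separated : (π σ : NCP n) → rel σ ≤R rel (kreweras π) ⇔ Separated (rel π) (rel σ)
  ≤kreweras⇔separated π σ = mk⇔
    (λ σ≤K x₁ x₂ y₁ y₂ x₁~x₂ y₁~y₂ → to ≤K⇔ σ≤K y₁ y₂ y₁~y₂ x₁ x₂ x₁~x₂)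
    (λ sep → from ≤K⇔ λ y₁ y₂ y₁~y₂ x₁ x₂ x₁~x₂ → sep x₁ x₂ y₁ y₂ x₁~x₂ y₁~y₂)
    where
    open Equivalence
    ≤K⇔ = ≤agreeRel⇔agree (rel π) evenSide {S = rel σ}

  ≤kreweras⁻¹⇔separated : (π σ : NCP n) → rel π ≤R rel (kreweras⁻¹ σ) ⇔ Separated (rel π) (rel σ)
  ≤kreweras⁻¹⇔separated π σ = mk⇔
    (λ π≤K x₁ x₂ y₁ y₂ x₁~x₂ y₁~y₂ →
      covers-transpose (odd x₁) (odd x₂) (even y₁) (even y₂) (to ≤K⇔ π≤K x₁ x₂ x₁~x₂ y₁ y₂ y₁~y₂))
    (λ sep → from ≤K⇔ λ x₁ x₂ x₁~x₂ y₁ y₂ y₁~y₂ →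
      inside-transpose (odd x₁) (odd x₂) (even y₁) (even y₂) (sep x₁ x₂ y₁ y₂ x₁~x₂ y₁~y₂))
    where
    open Equivalence
    ≤K⇔ = ≤agreeRel⇔agree (rel σ) oddSide {S = rel π}

  separated-joinʳ : (π σ₁ σ₂ ν : NCP n) → Separated (rel π) (rel σ₁) → Separated (rel π) (rel σ₂) →
                    IsJoinNCP (rel σ₁) (rel σ₂) ν → Separated (rel π) (rel ν)
  separated-joinʳ π σ₁ σ₂ ν sep₁ sep₂ (_ , _ , ν-least) =
    Equivalence.to (≤kreweras⇔separated π ν)
      (ν-least (kreweras π) (Equivalence.from (≤kreweras⇔separated π σ₁) sep₁)
                            (Equivalence.from (≤kreweras⇔separated π σ₂) sep₂))

  separated-joinˡ : (π₁ π₂ μ σ : NCP n) → Separated (rel π₁) (rel σ) → Separated (rel π₂) (rel σ) →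
                    IsJoinNCP (rel π₁) (rel π₂) μ → Separated (rel μ) (rel σ)
  separated-joinˡ π₁ π₂ μ σ sep₁ sep₂ (_ , _ , μ-least) =
    Equivalence.to (≤kreweras⁻¹⇔separated μ σ)
      (μ-least (kreweras⁻¹ σ) (Equivalence.from (≤kreweras⁻¹⇔separated π₁ σ) sep₁)
                              (Equivalence.from (≤kreweras⁻¹⇔separated π₂ σ) sep₂))

  PairwiseSeparated : NCP n → NCP n → NCP n → Set
  PairwiseSeparated α β γ = Separated (rel α) (rel β) × Separated (rel α) (rel γ) × Separated (rel β) (rel γ)

  leftDefined⇔pairwiseSeparated : (α β γ : NCP n) →
    (Σ[ μ ∈ NCP n ] (Comp α β μ × Admissible μ γ)) ⇔ PairwiseSeparated α β γ
  leftDefined⇔pairwiseSeparated α β γ = mk⇔ to from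
    where
    to : Σ[ μ ∈ NCP n ] (Comp α β μ × Admissible μ γ) → PairwiseSeparated α β γ
    to (μ , αβ↦μ@(αβ-adm , _) , μγ-adm) with comp⇒isJoin α β μ αβ↦μ
    ... | α≤μ , β≤μ , _ =
      admissible⇒separated α β αβ-adm , separated-anti α≤μ ≤R-refl μγ , separated-anti β≤μ ≤R-refl μγ
      where
      μγ = admissible⇒separated μ γ μγ-adm

    from : PairwiseSeparated α β γ → Σ[ μ ∈ NCP n ] (Comp α β μ × Admissible μ γ)
    from (αβ , αγ , βγ) =
      α ∨ β , isJoin⇒comp α β (α ∨ β) (separated⇒admissible α β αβ) ∨-isJoin ,
      separated⇒admissible (α ∨ β) γ (separated-joinˡ α β (α ∨ β) γ αγ βγ ∨-isJoin)
      where
      ∨-isJoin = join-isJoin (rel α) (rel β)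

  rightDefined⇔pairwiseSeparated : (α β γ : NCP n) →
    (Σ[ ν ∈ NCP n ] (Comp β γ ν × Admissible α ν)) ⇔ PairwiseSeparated α β γ
  rightDefined⇔pairwiseSeparated α β γ = mk⇔ to from
    where
    to : Σ[ ν ∈ NCP n ] (Comp β γ ν × Admissible α ν) → PairwiseSeparated α β γ
    to (ν , βγ↦ν@(βγ-adm , _) , αν-adm) with comp⇒isJoin β γ ν βγ↦ν
    ... | β≤ν , γ≤ν , _ =
      separated-anti ≤R-refl β≤ν αν , separated-anti ≤R-refl γ≤ν αν , admissible⇒separated β γ βγ-adm
      where
      αν = admissible⇒separated α ν αν-adm

    from : PairwiseSeparated α β γ → Σ[ ν ∈ NCP n ] (Comp β γ ν × Admissible α ν)
    from (αβ , αγ , βγ) =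
      β ∨ γ , isJoin⇒comp β γ (β ∨ γ) (separated⇒admissible β γ βγ) ∨-isJoin ,
      separated⇒admissible α (β ∨ γ) (separated-joinʳ α β γ (β ∨ γ) αβ αγ ∨-isJoin)
      where
      ∨-isJoin = join-isJoin (rel β) (rel γ)

-- The argument works for every n, so the hypothesis 1 ≤ n is unused.
proposition3p18 : (n : ℕ) → 1 ≤ n →
    -- ∘ is a map from admissible pairs to NCP(n): existence and uniqueness of the value
    ((α β : NCP n) → Admissible α β → Σ (NCP n) (λ μ → Comp α β μ)) ×
    ((α β μ μ′ : NCP n) → Comp α β μ → Comp α β μ′ → μ ≈P μ′) ×
    -- (α∘β)∘γ defined iff α∘(β∘γ) defined
    ((α β γ : NCP n) →
      (Σ[ μ ∈ NCP n ] (Comp α β μ × Admissible μ γ)) ⇔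
      (Σ[ ν ∈ NCP n ] (Comp β γ ν × Admissible α ν))) ×
    -- and then they are equal
    ((α β γ μ ν ρ σ : NCP n) → Comp α β μ → Comp μ γ ρ → Comp β γ ν → Comp α ν σ →
      ρ ≈P σ) ×
    -- 0_n is a neutral element
    ((α : NCP n) → Admissible (0P n) α × Admissible α (0P n)) ×
    ((α μ : NCP n) → Comp (0P n) α μ → μ ≈P α) ×
    ((α μ : NCP n) → Comp α (0P n) μ → μ ≈P α)
proposition3p18 n _ =
  (λ α β adm → α ∨ β , isJoin⇒comp α β (α ∨ β) adm (join-isJoin (rel α) (rel β))) ,
  (λ α β μ μ′ αβ↦μ αβ↦μ′ → isJoin-unique μ μ′ (comp⇒isJoin α β μ αβ↦μ) (comp⇒isJoin α β μ′ αβ↦μ′)) ,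
  (λ α β γ → ⇔-sym (rightDefined⇔pairwiseSeparated α β γ) ⇔-∘ leftDefined⇔pairwiseSeparated α β γ) ,
  (λ α β γ μ ν ρ σ αβ↦μ μγ↦ρ βγ↦ν αν↦σ →
    isJoin-assoc μ ρ ν σ (comp⇒isJoin α β μ αβ↦μ) (comp⇒isJoin μ γ ρ μγ↦ρ)
                 (comp⇒isJoin β γ ν βγ↦ν) (comp⇒isJoin α ν σ αν↦σ)) ,
  (λ α → separated⇒admissible (0P n) α separated-zeroˡ , separated⇒admissible α (0P n) separated-zeroʳ) ,
  (λ α μ 0α↦μ → isJoin-unique μ α (comp⇒isJoin (0P n) α μ 0α↦μ) (≤⇒isJoinˡ α (zeroRel-least α))) ,
  (λ α μ α0↦μ → isJoin-unique μ α (comp⇒isJoin α (0P n) μ α0↦μ) (≤⇒isJoinʳ α (zeroRel-least α)))
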